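{- Let $n$ be an odd positive integer such that $p = 2^4 n + 1$ is prime, and let $z$ be a quadratic nonresidue modulo $p$. Define $f_4(x) \in \mathbf{F}_p[x]$ by $$\begin{aligned} f_4(x) = 2^{ -3} x^{(n+1)/2}\Big[ &z^{7n}(1 - x^{4n})(1 - x^{2n} z^{4n})(1 - x^n z^{6n}) + z^{5n}(1 - x^{4n})(1 - x^n z^{2n})(1 + x^{2n} z^{4n}) \\ &+ z^{3n}(1 - x^{4n})(1 - x^{2n} z^{4n})(1 + x^n z^{6n}) + z^{n}(1 - x^{4n})(1 + x^n z^{2n})(1 + x^{2n} z^{4n}) \\ &+ z^{6n}(1 + x^{4n})(1 - x^{2n})(1 - x^n z^{4n}) + z^{2n}(1 + x^{4n})(1 - x^{2n})(1 + x^n z^{4n}) \\ &+ z^{4n}(1 + x^{4n})(1 + x^{2n})(1 - x^n) + (1 + x^{4n})(1 + x^{2n})(1 + x^n)\Big]. \end{aligned}$$ Then $f_4$ is a polynomial representation of the square root modulo $p$: for every quadratic residue $x$ modulo $p$, $\sqrt{x} \equiv \pm f_4(x) \pmod p$, i.e. $f_4(x)^2 \equiv x \pmod p$.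
   Context: A quadratic residue modulo $p$ is a nonzero $a$ with $a^{(p-1)/2} \equiv 1 \pmod p$; a quadratic nonresidue is a nonzero $z$ with $z^{(p-1)/2} \equiv -1 \pmod p$. Here $2^{ -3}$ denotes the inverse of $8$ in $\mathbf{F}_p$. -}

module Defs where

open import Data.Nat as ℕ using (ℕ)
open import Data.Nat.DivMod using (_/_)
open import Data.Integer using (ℤ; +_; _+_; _-_; _*_; _^_)
open import Data.Integer.Divisibility using (_∣_)
open import Relation.Binary.PropositionalEquality using (_≡_)
open import Relation.Nullary using (¬_)
open import Data.Product using (_×_)
import Data.Integer

infix 4 _≡_[mod_]
_≡_[mod_] : ℤ → ℤ → ℕ → Set
a ≡ b [mod p ] = (+ p) ∣ (a - b)

QuadResidue : ℕ → ℤ → Set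
QuadResidue p a = (¬ (a ≡ + 0 [mod p ])) × ((a ^ ((p ℕ.∸ 1) / 2)) ≡ (+ 1) [mod p ])

QuadNonResidue : ℕ → ℤ → Set
QuadNonResidue p z = (¬ (z ≡ + 0 [mod p ])) × ((z ^ ((p ℕ.∸ 1) / 2)) ≡ (Data.Integer.- (+ 1)) [mod p ])

-- f₄ n z inv8 x, where inv8 plays the role of 2^{-3} (an inverse of 8 mod p)
f₄ : ℕ → ℤ → ℤ → ℤ → ℤ
f₄ n z inv8 x = inv8 * x ^ ((n ℕ.+ 1) / 2) *
  ( z ^ (7 ℕ.* n) * (1ℤ - x ^ (4 ℕ.* n)) * (1ℤ - x ^ (2 ℕ.* n) * z ^ (4 ℕ.* n)) * (1ℤ - x ^ n * z ^ (6 ℕ.* n))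
  + z ^ (5 ℕ.* n) * (1ℤ - x ^ (4 ℕ.* n)) * (1ℤ - x ^ n * z ^ (2 ℕ.* n)) * (1ℤ + x ^ (2 ℕ.* n) * z ^ (4 ℕ.* n))
  + z ^ (3 ℕ.* n) * (1ℤ - x ^ (4 ℕ.* n)) * (1ℤ - x ^ (2 ℕ.* n) * z ^ (4 ℕ.* n)) * (1ℤ + x ^ n * z ^ (6 ℕ.* n))
  + z ^ n * (1ℤ - x ^ (4 ℕ.* n)) * (1ℤ + x ^ n * z ^ (2 ℕ.* n)) * (1ℤ + x ^ (2 ℕ.* n) * z ^ (4 ℕ.* n))
  + z ^ (6 ℕ.* n) * (1ℤ + x ^ (4 ℕ.* n)) * (1ℤ - x ^ (2 ℕ.* n)) * (1ℤ - x ^ n * z ^ (4 ℕ.* n))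
  + z ^ (2 ℕ.* n) * (1ℤ + x ^ (4 ℕ.* n)) * (1ℤ - x ^ (2 ℕ.* n)) * (1ℤ + x ^ n * z ^ (4 ℕ.* n))
  + z ^ (4 ℕ.* n) * (1ℤ + x ^ (4 ℕ.* n)) * (1ℤ + x ^ (2 ℕ.* n)) * (1ℤ - x ^ n)
  + (1ℤ + x ^ (4 ℕ.* n)) * (1ℤ + x ^ (2 ℕ.* n)) * (1ℤ + x ^ n) )
  where 1ℤ = + 1

-- Put Y = x^n and ζ = z^n. Euler's criterion gives Y^8 = 1 and ζ^8 = -1, so ζ is a
-- primitive 16th root of unity and, p being prime, Y is one of the eight even powers
-- ζ^(2i). For each of them the identity Y·B(Y, ζ)² = 64, where B is the bracket of
-- f₄, is a polynomial identity in ζ modulo ζ^8 + 1, checked by computing in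
-- ℤ[t]/(t^8 + 1). As n is odd, f₄(x)² = 2^(-6)·x^(n+1)·B(Y, ζ)² = 2^(-6)·x·64 = x.
module Submission where

open import Defs
open import Data.Nat using (ℕ; _%_) renaming (_+_ to _+ℕ_; _*_ to _*ℕ_; _^_ to _^ℕ_)
open import Data.Nat.Primality using (Prime)
open import Data.Integer using (ℤ; +_; _*_)
open import Relation.Binary.PropositionalEquality using (_≡_)

open import Algebra.Bundles.Raw using (RawRing)
import Algebra.Definitions.RawSemiring as RawSemiringDefinitions
open import Data.Fin using (Fin; zero; suc; toℕ; _↑ˡ_; _↑ʳ_)
open import Data.Fin.Properties using (toℕ-↑ˡ; toℕ-↑ʳ)
open import Data.Integer using (_+_; _-_; -_; _^_; 0ℤ; 1ℤ; -1ℤ; -[1+_]; ∣_∣)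
open import Data.Integer.Base using (+-*-rawRing)
open import Data.Integer.Divisibility.Signed using (_∣_; divides; ∣ᵤ⇒∣; ∣⇒∣ᵤ; ∣m⇒∣-m; ∣m∣n⇒∣m+n; ∣n⇒∣m*n)
import Data.Integer.Properties as ℤ
open import Data.Integer.Tactic.RingSolver using (solve-∀)
open import Data.Nat using (zero; suc; _∸_)
open import Data.Nat.DivMod using (_/_; m≡m%n+[m/n]*n; m*n/n≡m)
open import Data.Nat.Divisibility using () renaming (_∣_ to _∣ℕ_)
open import Data.Nat.Primality using (euclidsLemma)
import Data.Nat.Properties as ℕ
import Data.Nat.Tactic.RingSolver as ℕ-Solver
open import Data.Product using (Σ; _,_; uncurry)
open import Data.Sum as Sum using (_⊎_)
open import Data.Vec using (Vec; []; _∷_; _∷ʳ_; zipWith; map; replicate; init; last; initLast; lookup)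
open import Data.Vec.Relation.Binary.Pointwise.Inductive as Pointwise using (Pointwise; []; _∷_)
open import Function.Strict using (force; force-≡)
open import Level using (0ℓ)
open import Relation.Binary.Bundles using (Setoid)
open import Relation.Binary.PropositionalEquality using (refl; sym; trans; cong; cong₂; subst; module ≡-Reasoning)
import Relation.Binary.Reasoning.Setoid as SetoidReasoning

private
  variable
    k n : ℕ

^-^-comm : ∀ (a : ℤ) m n → (a ^ m) ^ n ≡ (a ^ n) ^ m
^-^-comm a m n = begin
  (a ^ m) ^ n   ≡⟨ ℤ.^-*-assoc a m n ⟩
  a ^ (m *ℕ n)  ≡⟨ cong (a ^_) (ℕ.*-comm m n) ⟩
  a ^ (n *ℕ m)  ≡⟨ ℤ.^-*-assoc a n m ⟨
  (a ^ n) ^ m   ∎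
  where open ≡-Reasoning

^-*-comm : ∀ (a : ℤ) k n → a ^ (k *ℕ n) ≡ (a ^ n) ^ k
^-*-comm a k n = trans (cong (a ^_) (ℕ.*-comm k n)) (sym (ℤ.^-*-assoc a n k))

module Modulo (p : ℕ) where

  private
    variable
      a b c d : ℤ

  -- A record rather than the divisibility itself, so that a and b can be inferred.
  infix 4 _≈_
  record _≈_ (a b : ℤ) : Set where
    constructor mod
    field
      divides-difference : + p ∣ a - b

  fromMod : a ≡ b [mod p ] → a ≈ b
  fromMod h = mod (∣ᵤ⇒∣ h)

  toMod : a ≈ b → a ≡ b [mod p ]
  toMod (mod h) = ∣⇒∣ᵤ h

  ≈-by : ∀ {e} → e ≡ a - b → + p ∣ e → a ≈ b
  ≈-by refl h = mod h

  ≈-refl : a ≈ a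
  ≈-refl {a} = ≈-by (sym (ℤ.+-inverseʳ a)) (divides 0ℤ refl)

  ≈-reflexive : a ≡ b → a ≈ b
  ≈-reflexive refl = ≈-refl

  ≈-sym : a ≈ b → b ≈ a
  ≈-sym {a} {b} (mod h) = ≈-by (negate-difference a b) (∣m⇒∣-m h)
    where
    negate-difference : ∀ a b → - (a - b) ≡ b - a
    negate-difference = solve-∀

  ≈-trans : a ≈ b → b ≈ c → a ≈ c
  ≈-trans {a} {b} {c} (mod h) (mod h′) = ≈-by (ℤ.+-minus-telescope a b c) (∣m∣n⇒∣m+n h h′)

  ≈-setoid : Setoid 0ℓ 0ℓ
  ≈-setoid = record
    { Carrier       = ℤ
    ; _≈_           = _≈_
    ; isEquivalence = record { refl = ≈-refl ; sym = ≈-sym ; trans = ≈-trans }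
    }

  module ≈-Reasoning = SetoidReasoning ≈-setoid

  +-cong : a ≈ b → c ≈ d → a + c ≈ b + d
  +-cong {a} {b} {c} {d} (mod h) (mod h′) = ≈-by (split a b c d) (∣m∣n⇒∣m+n h h′)
    where
    split : ∀ a b c d → (a - b) + (c - d) ≡ (a + c) - (b + d)
    split = solve-∀

  +-congˡ : ∀ a → b ≈ c → a + b ≈ a + c
  +-congˡ a = +-cong (≈-refl {a})

  +-congʳ : ∀ c → a ≈ b → a + c ≈ b + c
  +-congʳ c a≈b = +-cong a≈b (≈-refl {c})

  -‿cong : a ≈ b → - a ≈ - b
  -‿cong {a} {b} (mod h) = ≈-by (split a b) (∣m⇒∣-m h)
    where
    split : ∀ a b → - (a - b) ≡ - a - - b
    split = solve-∀

  *-cong : a ≈ b → c ≈ d → a * c ≈ b * d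
  *-cong {a} {b} {c} {d} (mod h) (mod h′) = ≈-by (split a b c d) (∣m∣n⇒∣m+n (∣n⇒∣m*n a h′) (∣n⇒∣m*n d h))
    where
    split : ∀ a b c d → a * (c - d) + d * (a - b) ≡ a * c - b * d
    split = solve-∀

  *-congˡ : ∀ a → b ≈ c → a * b ≈ a * c
  *-congˡ a = *-cong (≈-refl {a})

  *-congʳ : ∀ c → a ≈ b → a * c ≈ b * c
  *-congʳ c a≈b = *-cong a≈b (≈-refl {c})

  ∣m*n⇒∣m∨∣n : Prime p → + p ∣ a * b → (+ p ∣ a) ⊎ (+ p ∣ b)
  ∣m*n⇒∣m∨∣n {a} {b} p-prime h =
    Sum.map ∣ᵤ⇒∣ ∣ᵤ⇒∣ (euclidsLemma ∣ a ∣ ∣ b ∣ p-prime (subst (p ∣ℕ_) (ℤ.abs-* a b) (∣⇒∣ᵤ h)))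

  m²≈n²⇒m≈n∨m≈-n : Prime p → a ^ 2 ≈ b ^ 2 → a ≈ b ⊎ a ≈ - b
  m²≈n²⇒m≈n∨m≈-n {a} {b} p-prime (mod h) =
    Sum.map mod mod (∣m*n⇒∣m∨∣n p-prime (subst (+ p ∣_) (difference-of-squares a b) h))
    where
    -- a ^ 2 unfolds to a * (a * 1ℤ); the ring solver does not see through ℤ's _^_.
    difference-of-squares : ∀ a b → a * (a * 1ℤ) - b * (b * 1ℤ) ≡ (a - b) * (a - - b)
    difference-of-squares = solve-∀

  -- The square roots of ζ^(4i) are ±ζ^(2i), and -ζ^(2i) = ζ^(2(2^k + i)) because ζ^(2^(k+1)) = -1.
  square-roots-of-even-power : Prime p → ∀ k {ζ y} → ζ ^ (2 ^ℕ suc k) ≈ -1ℤ → (i : Fin (2 ^ℕ k)) →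
                               y ^ 2 ≈ (ζ ^ 2) ^ (2 *ℕ toℕ i) → Σ (Fin (2 ^ℕ suc k)) λ j → y ≈ ζ ^ (2 *ℕ toℕ j)
  square-roots-of-even-power p-prime k {ζ} {y} ζ^2^[1+k]≈-1 i y²≈ζ²^[2i] =
    Sum.[ (λ y≈w → i ↑ˡ (2 ^ℕ k +ℕ 0) , subst (λ j → y ≈ ζ ^ (2 *ℕ j)) (sym (toℕ-↑ˡ i (2 ^ℕ k +ℕ 0))) y≈w)
        , (λ y≈-w → 2 ^ℕ k ↑ʳ (i ↑ˡ 0) , ≈-trans y≈-w -w≈ζ^[2[2^k+i]])
        ]′ (m²≈n²⇒m≈n∨m≈-n p-prime (≈-trans y²≈ζ²^[2i] (≈-reflexive (^-^-comm ζ 2 (2 *ℕ toℕ i)))))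
    where
    open ≈-Reasoning
    exponent : 2 ^ℕ suc k +ℕ 2 *ℕ toℕ i ≡ 2 *ℕ toℕ (2 ^ℕ k ↑ʳ (i ↑ˡ 0))
    exponent = sym (trans (cong (2 *ℕ_) (trans (toℕ-↑ʳ (2 ^ℕ k) (i ↑ˡ 0)) (cong (2 ^ℕ k +ℕ_) (toℕ-↑ˡ i 0))))
                          (ℕ.*-distribˡ-+ 2 (2 ^ℕ k) (toℕ i)))
    -w≈ζ^[2[2^k+i]] : - ζ ^ (2 *ℕ toℕ i) ≈ ζ ^ (2 *ℕ toℕ (2 ^ℕ k ↑ʳ (i ↑ˡ 0)))
    -w≈ζ^[2[2^k+i]] = begin
      - ζ ^ (2 *ℕ toℕ i)                  ≡⟨ ℤ.-1*i≡-i (ζ ^ (2 *ℕ toℕ i)) ⟨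
      -1ℤ * ζ ^ (2 *ℕ toℕ i)              ≈⟨ *-congʳ (ζ ^ (2 *ℕ toℕ i)) ζ^2^[1+k]≈-1 ⟨
      ζ ^ (2 ^ℕ suc k) * ζ ^ (2 *ℕ toℕ i) ≡⟨ ℤ.^-distribˡ-+-* ζ (2 ^ℕ suc k) (2 *ℕ toℕ i) ⟨
      ζ ^ (2 ^ℕ suc k +ℕ 2 *ℕ toℕ i)      ≡⟨ cong (ζ ^_) exponent ⟩
      ζ ^ (2 *ℕ toℕ (2 ^ℕ k ↑ʳ (i ↑ˡ 0))) ∎

  root-of-unity⇒even-power : Prime p → ∀ k {ζ y} → ζ ^ (2 ^ℕ k) ≈ -1ℤ → y ^ (2 ^ℕ k) ≈ 1ℤ →
                             Σ (Fin (2 ^ℕ k)) λ i → y ≈ ζ ^ (2 *ℕ toℕ i)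
  root-of-unity⇒even-power p-prime zero {y = y} _ y¹≈1 = zero , ≈-trans (≈-reflexive (sym (ℤ.^-identityʳ y))) y¹≈1
  root-of-unity⇒even-power p-prime (suc k) {ζ} {y} ζ^2^[1+k]≈-1 y^2^[1+k]≈1 =
    uncurry (square-roots-of-even-power p-prime k {ζ} {y} ζ^2^[1+k]≈-1)
            (root-of-unity⇒even-power p-prime k {ζ ^ 2} {y ^ 2} (squared ζ ζ^2^[1+k]≈-1) (squared y y^2^[1+k]≈1))
    where
    squared : ∀ a {b} → a ^ (2 ^ℕ suc k) ≈ b → (a ^ 2) ^ (2 ^ℕ k) ≈ b
    squared a = ≈-trans (≈-reflexive (ℤ.^-*-assoc a 2 (2 ^ℕ k)))

data Expr (n : ℕ) : Set where
  var  : Fin n → Expr n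
  one  : Expr n
  _:+_ : Expr n → Expr n → Expr n
  _:*_ : Expr n → Expr n → Expr n
  :-_  : Expr n → Expr n
  _:^_ : Expr n → ℕ → Expr n

infixl 6 _:+_ _:-_
infixl 7 _:*_
infix  8 :-_
infixr 9 _:^_

_:-_ : Expr n → Expr n → Expr n
e :- f = e :+ :- f

module Interpretation (ring : RawRing 0ℓ 0ℓ) where

  private
    module R = RawRing ring

  open RawSemiringDefinitions R.rawSemiring public using () renaming (_^_ to _^ᴿ_)

  ⟦_⟧ : Expr n → Vec R.Carrier n → R.Carrier
  ⟦ var i  ⟧ ρ = lookup ρ i
  ⟦ one    ⟧ ρ = R.1#
  ⟦ e :+ f ⟧ ρ = ⟦ e ⟧ ρ R.+ ⟦ f ⟧ ρ
  ⟦ e :* f ⟧ ρ = ⟦ e ⟧ ρ R.* ⟦ f ⟧ ρ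
  ⟦ :- e   ⟧ ρ = R.- ⟦ e ⟧ ρ
  ⟦ e :^ k ⟧ ρ = ⟦ e ⟧ ρ ^ᴿ k

open Interpretation +-*-rawRing renaming (⟦_⟧ to ⟦_⟧ᶻ; _^ᴿ_ to _^ᶻ_)

^ᶻ≡^ : ∀ a k → a ^ᶻ k ≡ a ^ k
^ᶻ≡^ a zero    = refl
^ᶻ≡^ a (suc k) = cong (a *_) (^ᶻ≡^ a k)

-- Forcing every coefficient shares the normal form: t⊠_ uses its argument twice, and
-- without this the normalisation in identity-at-roots blows up exponentially.
force-ℤ : {B : Set} → ℤ → (ℤ → B) → B
force-ℤ (+ n)    f = force n λ n′ → f (+ n′)
force-ℤ -[1+ n ] f = force n λ n′ → f -[1+ n′ ]

force-ℤ-≡ : {B : Set} (a : ℤ) (f : ℤ → B) → force-ℤ a f ≡ f a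
force-ℤ-≡ (+ n)    f = force-≡ n λ n′ → f (+ n′)
force-ℤ-≡ -[1+ n ] f = force-≡ n λ n′ → f -[1+ n′ ]

evaluated : Vec ℤ k → Vec ℤ k
evaluated []      = []
evaluated (a ∷ v) = force-ℤ a λ a′ → force (evaluated v) (a′ ∷_)

evaluated-≡ : (v : Vec ℤ k) → evaluated v ≡ v
evaluated-≡ []      = refl
evaluated-≡ (a ∷ v) = begin
  force-ℤ a (λ a′ → force (evaluated v) (a′ ∷_)) ≡⟨ force-ℤ-≡ a _ ⟩
  force (evaluated v) (a ∷_)                     ≡⟨ force-≡ (evaluated v) (a ∷_) ⟩
  a ∷ evaluated v                                ≡⟨ cong (a ∷_) (evaluated-≡ v) ⟩
  a ∷ v                                          ∎
  where open ≡-Reasoning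

-- Poly m represents ℤ[t]/(t^(m+1) + 1), coefficients listed from the constant term upwards.
Poly : ℕ → Set
Poly m = Vec ℤ (suc m)

module _ {m : ℕ} where

  infixl 6 _⊞_
  infixr 7 _⊠_
  infix  8 t⊠_

  constant : ℤ → Poly m
  constant c = c ∷ replicate m 0ℤ

  _⊞_ : Poly m → Poly m → Poly m
  _⊞_ = zipWith _+_

  ⊟_ : Poly m → Poly m
  ⊟_ = map (-_)

  t⊠_ : Poly m → Poly m
  t⊠ v = evaluated (- last v ∷ init v)

  _⊠_ : Vec ℤ k → Poly m → Poly m
  []      ⊠ w = constant 0ℤ
  (a ∷ u) ⊠ w = map (a *_) w ⊞ t⊠ (u ⊠ w)

  t : Poly m
  t = t⊠ constant 1ℤ

negacyclic : ℕ → RawRing 0ℓ 0ℓ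
negacyclic m = record
  { Carrier = Poly m
  ; _≈_     = _≡_
  ; _+_     = _⊞_
  ; _*_     = _⊠_
  ; -_      = ⊟_
  ; 0#      = constant 0ℤ
  ; 1#      = constant 1ℤ
  }

module _ {m : ℕ} where
  open Interpretation (negacyclic m) public renaming (⟦_⟧ to ⟦_⟧ᴾ; _^ᴿ_ to _^ᴾ_)

module Horner (ζ : ℤ) where

  eval : Vec ℤ k → ℤ
  eval []      = 0ℤ
  eval (a ∷ v) = a + ζ * eval v

  eval-replicate : ∀ k → eval (replicate k 0ℤ) ≡ 0ℤ
  eval-constant : ∀ k c → eval (c ∷ replicate k 0ℤ) ≡ c

  eval-replicate zero    = refl
  eval-replicate (suc k) = eval-constant k 0ℤ

  eval-constant k c = begin
    c + ζ * eval (replicate k 0ℤ) ≡⟨ cong (λ e → c + ζ * e) (eval-replicate k) ⟩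
    c + ζ * 0ℤ                    ≡⟨ cong (λ e → c + e) (ℤ.*-zeroʳ ζ) ⟩
    c + 0ℤ                        ≡⟨ ℤ.+-identityʳ c ⟩
    c                             ∎
    where open ≡-Reasoning

  eval-zipWith-+ : (u v : Vec ℤ k) → eval (zipWith _+_ u v) ≡ eval u + eval v
  eval-zipWith-+ []      []      = refl
  eval-zipWith-+ (a ∷ u) (b ∷ v) = begin
    a + b + ζ * eval (zipWith _+_ u v) ≡⟨ cong (λ e → a + b + ζ * e) (eval-zipWith-+ u v) ⟩
    a + b + ζ * (eval u + eval v)      ≡⟨ regroup a b ζ (eval u) (eval v) ⟩
    a + ζ * eval u + (b + ζ * eval v)  ∎
    where
    open ≡-Reasoning
    regroup : ∀ a b ζ e f → a + b + ζ * (e + f) ≡ a + ζ * e + (b + ζ * f)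
    regroup = solve-∀

  eval-map-* : ∀ c (v : Vec ℤ k) → eval (map (c *_) v) ≡ c * eval v
  eval-map-* c []      = sym (ℤ.*-zeroʳ c)
  eval-map-* c (a ∷ v) = begin
    c * a + ζ * eval (map (c *_) v) ≡⟨ cong (λ e → c * a + ζ * e) (eval-map-* c v) ⟩
    c * a + ζ * (c * eval v)        ≡⟨ factor c a ζ (eval v) ⟩
    c * (a + ζ * eval v)            ∎
    where
    open ≡-Reasoning
    factor : ∀ c a ζ e → c * a + ζ * (c * e) ≡ c * (a + ζ * e)
    factor = solve-∀

  eval-map-neg : (v : Vec ℤ k) → eval (map (-_) v) ≡ - eval v
  eval-map-neg []      = refl
  eval-map-neg (a ∷ v) = begin
    - a + ζ * eval (map (-_) v) ≡⟨ cong (λ e → - a + ζ * e) (eval-map-neg v) ⟩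
    - a + ζ * - eval v        ≡⟨ factor a ζ (eval v) ⟩
    - (a + ζ * eval v)        ∎
    where
    open ≡-Reasoning
    factor : ∀ a ζ e → - a + ζ * - e ≡ - (a + ζ * e)
    factor = solve-∀

  eval-∷ʳ : ∀ (v : Vec ℤ k) c → eval (v ∷ʳ c) ≡ eval v + ζ ^ k * c
  eval-∷ʳ []      c = unit c ζ
    where
    unit : ∀ c ζ → c + ζ * 0ℤ ≡ 0ℤ + 1ℤ * c
    unit = solve-∀
  eval-∷ʳ {suc k} (a ∷ v) c = begin
    a + ζ * eval (v ∷ʳ c)           ≡⟨ cong (λ e → a + ζ * e) (eval-∷ʳ v c) ⟩
    a + ζ * (eval v + ζ ^ k * c)    ≡⟨ regroup a ζ (eval v) (ζ ^ k) c ⟩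
    a + ζ * eval v + ζ * ζ ^ k * c  ∎
    where
    open ≡-Reasoning
    regroup : ∀ a ζ e q c → a + ζ * (e + q * c) ≡ a + ζ * e + ζ * q * c
    regroup = solve-∀

module Evaluation {p m : ℕ} {ζ : ℤ} (ζ^[1+m]≈-1 : Modulo._≈_ p (ζ ^ suc m) -1ℤ) where

  open Modulo p
  open Horner ζ public
  open ≈-Reasoning

  eval-t⊠ : ∀ (v : Poly m) → eval (t⊠ v) ≈ ζ * eval v
  eval-t⊠ v with initLast v
  ... | u , c , refl = begin
    eval (evaluated (- c ∷ u))                         ≡⟨ cong eval (evaluated-≡ (- c ∷ u)) ⟩
    - c + ζ * eval u                                   ≡⟨ cong (_+ ζ * eval u) (ℤ.-1*i≡-i c) ⟨
    -1ℤ * c + ζ * eval u                               ≈⟨ +-congʳ (ζ * eval u) (*-congʳ c ζ^[1+m]≈-1) ⟨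
    ζ * ζ ^ m * c + ζ * eval u                         ≡⟨ factor ζ (ζ ^ m) c (eval u) ⟩
    ζ * (eval u + ζ ^ m * c)                           ≡⟨ cong (ζ *_) (eval-∷ʳ u c) ⟨
    ζ * eval (u ∷ʳ c)                                  ∎
    where
    factor : ∀ ζ q c e → ζ * q * c + ζ * e ≡ ζ * (e + q * c)
    factor = solve-∀

  eval-⊠ : ∀ (u : Vec ℤ k) (w : Poly m) → eval (u ⊠ w) ≈ eval u * eval w
  eval-⊠ []      w = ≈-reflexive (eval-constant m 0ℤ)
  eval-⊠ (a ∷ u) w = begin
    eval (map (a *_) w ⊞ t⊠ (u ⊠ w))       ≡⟨ eval-zipWith-+ (map (a *_) w) (t⊠ (u ⊠ w)) ⟩
    eval (map (a *_) w) + eval (t⊠ (u ⊠ w)) ≡⟨ cong (_+ eval (t⊠ (u ⊠ w))) (eval-map-* a w) ⟩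
    a * eval w + eval (t⊠ (u ⊠ w))         ≈⟨ +-congˡ (a * eval w) (eval-t⊠ (u ⊠ w)) ⟩
    a * eval w + ζ * eval (u ⊠ w)              ≈⟨ +-congˡ (a * eval w) (*-congˡ ζ (eval-⊠ u w)) ⟩
    a * eval w + ζ * (eval u * eval w)         ≡⟨ factor a ζ (eval u) (eval w) ⟩
    (a + ζ * eval u) * eval w                  ∎
    where
    factor : ∀ a ζ e f → a * f + ζ * (e * f) ≡ (a + ζ * e) * f
    factor = solve-∀

  eval-^ : ∀ {u : Poly m} {a} → eval u ≈ a → ∀ k → eval (u ^ᴾ k) ≈ a ^ᶻ k
  eval-^     u≈a zero    = ≈-reflexive (eval-constant m 1ℤ)
  eval-^ {u} u≈a (suc k) = ≈-trans (eval-⊠ u (u ^ᴾ k)) (*-cong u≈a (eval-^ u≈a k))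

  eval-t : eval (t {m}) ≈ ζ
  eval-t = ≈-trans (eval-t⊠ (constant 1ℤ)) (≈-reflexive (trans (cong (ζ *_) (eval-constant m 1ℤ)) (ℤ.*-identityʳ ζ)))

  eval-⟦⟧ : ∀ (e : Expr n) (ρ : Vec (Poly m) n) {σ} → Pointwise (λ u a → eval u ≈ a) ρ σ → eval (⟦ e ⟧ᴾ ρ) ≈ ⟦ e ⟧ᶻ σ
  eval-⟦⟧ (var i)  ρ ρ≈σ = Pointwise.lookup ρ≈σ i
  eval-⟦⟧ one      ρ ρ≈σ = ≈-reflexive (eval-constant m 1ℤ)
  eval-⟦⟧ (e :+ f) ρ ρ≈σ =
    ≈-trans (≈-reflexive (eval-zipWith-+ (⟦ e ⟧ᴾ ρ) (⟦ f ⟧ᴾ ρ))) (+-cong (eval-⟦⟧ e ρ ρ≈σ) (eval-⟦⟧ f ρ ρ≈σ))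
  eval-⟦⟧ (e :* f) ρ ρ≈σ = ≈-trans (eval-⊠ (⟦ e ⟧ᴾ ρ) (⟦ f ⟧ᴾ ρ)) (*-cong (eval-⟦⟧ e ρ ρ≈σ) (eval-⟦⟧ f ρ ρ≈σ))
  eval-⟦⟧ (:- e)   ρ ρ≈σ = ≈-trans (≈-reflexive (eval-map-neg (⟦ e ⟧ᴾ ρ))) (-‿cong (eval-⟦⟧ e ρ ρ≈σ))
  eval-⟦⟧ (e :^ k) ρ ρ≈σ = eval-^ (eval-⟦⟧ e ρ ρ≈σ) k

X Z : Expr 2
X = var zero
Z = var (suc zero)

bracket : Expr 2
bracket =
     Z :^ 7 :* (one :- X :^ 4) :* (one :- X :^ 2 :* Z :^ 4) :* (one :- X :* Z :^ 6)
  :+ Z :^ 5 :* (one :- X :^ 4) :* (one :- X :* Z :^ 2) :* (one :+ X :^ 2 :* Z :^ 4)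
  :+ Z :^ 3 :* (one :- X :^ 4) :* (one :- X :^ 2 :* Z :^ 4) :* (one :+ X :* Z :^ 6)
  :+ Z :* (one :- X :^ 4) :* (one :+ X :* Z :^ 2) :* (one :+ X :^ 2 :* Z :^ 4)
  :+ Z :^ 6 :* (one :+ X :^ 4) :* (one :- X :^ 2) :* (one :- X :* Z :^ 4)
  :+ Z :^ 2 :* (one :+ X :^ 4) :* (one :- X :^ 2) :* (one :+ X :* Z :^ 4)
  :+ Z :^ 4 :* (one :+ X :^ 4) :* (one :+ X :^ 2) :* (one :- X)
  :+ (one :+ X :^ 4) :* (one :+ X :^ 2) :* (one :+ X)

X·bracket² : Expr 2
X·bracket² = X :* bracket :* bracket

identity-at-roots : ∀ (i : Fin 8) → ⟦ X·bracket² ⟧ᴾ (t ^ᴾ (2 *ℕ toℕ i) ∷ t ∷ []) ≡ constant {7} (+ 64)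
identity-at-roots zero                                      = refl
identity-at-roots (suc zero)                                = refl
identity-at-roots (suc (suc zero))                          = refl
identity-at-roots (suc (suc (suc zero)))                    = refl
identity-at-roots (suc (suc (suc (suc zero))))              = refl
identity-at-roots (suc (suc (suc (suc (suc zero)))))        = refl
identity-at-roots (suc (suc (suc (suc (suc (suc zero))))))  = refl
identity-at-roots (suc (suc (suc (suc (suc (suc (suc zero))))))) = refl

module _ {p : ℕ} where
  open Modulo p

  X·bracket²≈64-at-root : ∀ ζ y → ζ ^ 8 ≈ -1ℤ → (i : Fin 8) → y ≈ ζ ^ (2 *ℕ toℕ i) → ⟦ X·bracket² ⟧ᶻ (y ∷ ζ ∷ []) ≈ + 64
  X·bracket²≈64-at-root ζ y ζ⁸≈-1 i y≈ζ^2i = begin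
    ⟦ X·bracket² ⟧ᶻ (y ∷ ζ ∷ [])                         ≈⟨ eval-⟦⟧ X·bracket² (t ^ᴾ (2 *ℕ toℕ i) ∷ t ∷ []) (t^2i≈y ∷ eval-t ∷ []) ⟨
    eval (⟦ X·bracket² ⟧ᴾ (t ^ᴾ (2 *ℕ toℕ i) ∷ t ∷ []))  ≡⟨ cong eval (identity-at-roots i) ⟩
    eval (constant {7} (+ 64))                           ≡⟨ eval-constant 7 (+ 64) ⟩
    + 64                                                 ∎
    where
    open Evaluation {p} {7} {ζ} ζ⁸≈-1
    open ≈-Reasoning
    t^2i≈y : eval (t ^ᴾ (2 *ℕ toℕ i)) ≈ y
    t^2i≈y = begin
      eval (t ^ᴾ (2 *ℕ toℕ i)) ≈⟨ eval-^ eval-t (2 *ℕ toℕ i) ⟩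
      ζ ^ᶻ (2 *ℕ toℕ i)        ≡⟨ ^ᶻ≡^ ζ (2 *ℕ toℕ i) ⟩
      ζ ^ (2 *ℕ toℕ i)         ≈⟨ y≈ζ^2i ⟨
      y                        ∎

  X·bracket²≈64 : Prime p → ∀ ζ y → ζ ^ 8 ≈ -1ℤ → y ^ 8 ≈ 1ℤ → ⟦ X·bracket² ⟧ᶻ (y ∷ ζ ∷ []) ≈ + 64
  X·bracket²≈64 p-prime ζ y ζ⁸≈-1 y⁸≈1 =
    uncurry (X·bracket²≈64-at-root ζ y ζ⁸≈-1) (root-of-unity⇒even-power p-prime 3 {ζ} {y} ζ⁸≈-1 y⁸≈1)

f₄≡bracket : ∀ n z i x → f₄ n z i x ≡ i * x ^ ((n +ℕ 1) / 2) * ⟦ bracket ⟧ᶻ (x ^ n ∷ z ^ n ∷ [])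
f₄≡bracket n z i x
  rewrite ^-*-comm x 4 n | ^-*-comm x 2 n | ^-*-comm z 7 n | ^-*-comm z 6 n
        | ^-*-comm z 5 n | ^-*-comm z 4 n | ^-*-comm z 3 n | ^-*-comm z 2 n = refl

odd⇒half+half≡suc : ∀ n → n % 2 ≡ 1 → (n +ℕ 1) / 2 +ℕ (n +ℕ 1) / 2 ≡ suc n
odd⇒half+half≡suc n odd = begin
  (n +ℕ 1) / 2 +ℕ (n +ℕ 1) / 2     ≡⟨ cong (λ m → m / 2 +ℕ m / 2) n+1≡[1+q]*2 ⟩
  suc q *ℕ 2 / 2 +ℕ suc q *ℕ 2 / 2 ≡⟨ cong₂ _+ℕ_ (m*n/n≡m (suc q) 2) (m*n/n≡m (suc q) 2) ⟩
  suc q +ℕ suc q                   ≡⟨ double (suc q) ⟩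
  suc q *ℕ 2                       ≡⟨ n+1≡[1+q]*2 ⟨
  n +ℕ 1                           ≡⟨ ℕ.+-comm n 1 ⟩
  suc n                            ∎
  where
  open ≡-Reasoning
  q : ℕ
  q = n / 2
  double : ∀ m → m +ℕ m ≡ m *ℕ 2
  double = ℕ-Solver.solve-∀
  n+1≡[1+q]*2 : n +ℕ 1 ≡ suc q *ℕ 2
  n+1≡[1+q]*2 = begin
    n +ℕ 1               ≡⟨ cong (_+ℕ 1) (m≡m%n+[m/n]*n n 2) ⟩
    n % 2 +ℕ q *ℕ 2 +ℕ 1 ≡⟨ cong (λ r → r +ℕ q *ℕ 2 +ℕ 1) odd ⟩
    suc (q *ℕ 2 +ℕ 1)    ≡⟨ cong suc (ℕ.+-comm (q *ℕ 2) 1) ⟩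
    suc q *ℕ 2           ∎

f₄² : ∀ n → n % 2 ≡ 1 → ∀ z i x → f₄ n z i x * f₄ n z i x ≡ i * i * x * ⟦ X·bracket² ⟧ᶻ (x ^ n ∷ z ^ n ∷ [])
f₄² n odd z i x = begin
  f₄ n z i x * f₄ n z i x        ≡⟨ cong₂ _*_ (f₄≡bracket n z i x) (f₄≡bracket n z i x) ⟩
  i * r * B * (i * r * B)        ≡⟨ regroup i r B ⟩
  i * i * (r * r) * (B * B)      ≡⟨ cong (λ s → i * i * s * (B * B)) r² ⟩
  i * i * (x * x ^ n) * (B * B)  ≡⟨ regroup′ i x (x ^ n) B ⟩
  i * i * x * (x ^ n * B * B)    ∎
  where
  open ≡-Reasoning
  r : ℤ
  r = x ^ ((n +ℕ 1) / 2)
  B : ℤ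
  B = ⟦ bracket ⟧ᶻ (x ^ n ∷ z ^ n ∷ [])
  r² : r * r ≡ x * x ^ n
  r² = trans (sym (ℤ.^-distribˡ-+-* x ((n +ℕ 1) / 2) ((n +ℕ 1) / 2))) (cong (x ^_) (odd⇒half+half≡suc n odd))
  regroup : ∀ i r B → i * r * B * (i * r * B) ≡ i * i * (r * r) * (B * B)
  regroup = solve-∀
  regroup′ : ∀ i x Y B → i * i * (x * Y) * (B * B) ≡ i * i * x * (Y * B * B)
  regroup′ = solve-∀

euler-exponent : ∀ n (a : ℤ) → a ^ ((2 ^ℕ 4 *ℕ n +ℕ 1 ∸ 1) / 2) ≡ (a ^ n) ^ 8
euler-exponent n a = trans (cong (a ^_) exponent) (sym (ℤ.^-*-assoc a n 8))
  where
  sixteen : ∀ n → 16 *ℕ n ≡ n *ℕ 8 *ℕ 2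
  sixteen = ℕ-Solver.solve-∀
  exponent : (2 ^ℕ 4 *ℕ n +ℕ 1 ∸ 1) / 2 ≡ n *ℕ 8
  exponent = trans (cong (_/ 2) (trans (ℕ.m+n∸n≡m (16 *ℕ n) 1) (sixteen n))) (m*n/n≡m (n *ℕ 8) 2)

mainTheorem4 : (n : ℕ) → n % 2 ≡ 1 → Prime (2 ^ℕ 4 *ℕ n +ℕ 1) →
    (z : ℤ) → QuadNonResidue (2 ^ℕ 4 *ℕ n +ℕ 1) z →
    (inv8 : ℤ) → ((+ 8) * inv8) ≡ (+ 1) [mod (2 ^ℕ 4 *ℕ n +ℕ 1) ] →
    (x : ℤ) → QuadResidue (2 ^ℕ 4 *ℕ n +ℕ 1) x →
    (f₄ n z inv8 x * f₄ n z inv8 x) ≡ x [mod (2 ^ℕ 4 *ℕ n +ℕ 1) ]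
mainTheorem4 n odd p-prime z (_ , z^[8n]≡-1) inv8 8·inv8≡1 x (_ , x^[8n]≡1) = toMod (begin
  f₄ n z inv8 x * f₄ n z inv8 x                                ≡⟨ f₄² n odd z inv8 x ⟩
  inv8 * inv8 * x * ⟦ X·bracket² ⟧ᶻ (x ^ n ∷ z ^ n ∷ [])       ≈⟨ *-congˡ (inv8 * inv8 * x) (X·bracket²≈64 p-prime (z ^ n) (x ^ n) ζ⁸≈-1 Y⁸≈1) ⟩
  inv8 * inv8 * x * + 64                                       ≡⟨ regroup inv8 x ⟩
  x * (+ 8 * inv8 * (+ 8 * inv8))                              ≈⟨ *-congˡ x (*-cong 8·inv8≈1 8·inv8≈1) ⟩
  x * 1ℤ                                                       ≡⟨ ℤ.*-identityʳ x ⟩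
  x                                                            ∎)
  where
  open Modulo (2 ^ℕ 4 *ℕ n +ℕ 1)
  open ≈-Reasoning
  ζ⁸≈-1 : (z ^ n) ^ 8 ≈ -1ℤ
  ζ⁸≈-1 = ≈-trans (≈-reflexive (sym (euler-exponent n z))) (fromMod z^[8n]≡-1)
  Y⁸≈1 : (x ^ n) ^ 8 ≈ 1ℤ
  Y⁸≈1 = ≈-trans (≈-reflexive (sym (euler-exponent n x))) (fromMod x^[8n]≡1)
  8·inv8≈1 : + 8 * inv8 ≈ 1ℤ
  8·inv8≈1 = fromMod 8·inv8≡1
  regroup : ∀ i x → i * i * x * + 64 ≡ x * (+ 8 * i * (+ 8 * i))
  regroup = solve-∀
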